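{- For all $b\in\mathbb{F}_p$ and $c\in\mathbb{F}_p^*$, the tiling $H_{b,c}$ is self-similar; more precisely $\sigma^p(H_{b,c})=H_{b,c}$ (with $\sigma^p$ applied to every tile and inflation by $2^p$ about the central vertex).
   Context: Let $p$ be an odd prime, $\mathbb{F}_p$ the field with $p$ elements, $\mathbb{F}_p^*=\mathbb{F}_p\setminus\{0\}$. A tile is a unit equilateral triangle of the standard triangular lattice in the plane, oriented upward or downward, whose corners are decorated with elements of $\mathbb{F}_p$. $\triangle(x,y,z)$ is the upward tile with bottom-left, bottom-right, top corners $x,y,z$; $\triangledown(x,y,z)$ the downward tile with top-right, top-left, bottom corners $x,y,z$. The substitution $\sigma$ inflates a tile by factor $2$ and replaces it by four unit tiles: $\sigma(\triangle(x,y,z))$ consists of bottom-left $\triangle(x,x+y,x+z)$, bottom-right $\triangle(x+y,y,y+z)$, top $\triangle(x+z,y+z,z)$ and central $\triangledown(y+z,x+z,x+y)$; $\sigma(\triangledown(x,y,z))$ consists of top-right $\triangledown(x,x+y,x+z)$, top-left $\triangledown(x+y,y,y+z)$, bottom $\triangledown(x+z,y+z,z)$ and central $\triangle(y+z,x+z,x+y)$. $\sigma$ acts on patches tile by tile, with inflation about a fixed point. For $b\in\mathbb{F}_p$, $c\in\mathbb{F}_p^*$, let $h_{b,c}$ be the hexagonal patch of the six unit tiles sharing a common vertex $v$ (placed at the origin), decorated with $c$ at $v$ and $b$ at each of the six other vertices. Let $h_{b,c}(k)=\sigma^{kp}(h_{b,c})$ with inflation by $2^{kp}$ about $v$. The patches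 $h_{b,c}(k)$ are nested ($h_{b,c}(k)\subset h_{b,c}(k+1)$, each having value $c$ at $v$ surrounded by $b$'s), and their union is a decorated tiling of the plane denoted $H_{b,c}$. -}

module Defs where

open import Data.Nat using (ℕ; zero; suc; _*_)
import Data.Nat as ℕ
open import Data.Nat.DivMod using (_mod_)
open import Data.Fin using (Fin; toℕ)
open import Data.Integer using (ℤ; +_; -[1+_])
import Data.Integer as ℤ
open import Data.List using (List; []; _∷_; _++_; concatMap)
open import Data.List.Membership.Propositional using (_∈_)
open import Data.Product using (Σ; ∃; _×_; _,_)

𝔽 : ℕ → Set
𝔽 p = Fin p

_⊕_ : {p : ℕ} → 𝔽 p → 𝔽 p → 𝔽 p
_⊕_ {suc n} x y = (toℕ x ℕ.+ toℕ y) mod (suc n)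

data Orient : Set where
  up down : Orient

-- Lattice conventions: vertex (i , j) of the triangular lattice sits at
-- i·(1,0) + j·(1/2, √3/2).
--  * up   tile at index (i , j): bottom-left (i,j), bottom-right (i+1,j), top (i,j+1).
--  * down tile at index (i , j): top-right (i+1,j+1), top-left (i,j+1), bottom (i+1,j).
-- Decoration (x , y , z) follows the paper: △(x,y,z) = (bottom-left, bottom-right, top),
-- ▽(x,y,z) = (top-right, top-left, bottom).
record Tile (p : ℕ) : Set where
  constructor tile
  field
    orient : Orient
    i j    : ℤ
    x y z  : 𝔽 p

two : ℤ → ℤ
two a = a ℤ.+ a

one : ℤ
one = + 1

children : {p : ℕ} → Tile p → List (Tile p)
children (tile up i j x y z) =
    tile up   (two i)         (two j)         x         (x ⊕ y)   (x ⊕ z)   -- bottom-left △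
  ∷ tile up   (two i ℤ.+ one) (two j)         (x ⊕ y)   y         (y ⊕ z)   -- bottom-right △
  ∷ tile up   (two i)         (two j ℤ.+ one) (x ⊕ z)   (y ⊕ z)   z         -- top △
  ∷ tile down (two i)         (two j)         (y ⊕ z)   (x ⊕ z)   (x ⊕ y)   -- central ▽
  ∷ []
children (tile down i j x y z) =
    tile down (two i ℤ.+ one) (two j ℤ.+ one) x         (x ⊕ y)   (x ⊕ z)   -- top-right ▽
  ∷ tile down (two i)         (two j ℤ.+ one) (x ⊕ y)   y         (y ⊕ z)   -- top-left ▽
  ∷ tile down (two i ℤ.+ one) (two j)         (x ⊕ z)   (y ⊕ z)   z         -- bottom ▽
  ∷ tile up   (two i ℤ.+ one) (two j ℤ.+ one) (y ⊕ z)   (x ⊕ z)   (x ⊕ y)   -- central △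
  ∷ []

Patch : ℕ → Set
Patch p = List (Tile p)

σ : {p : ℕ} → Patch p → Patch p
σ = concatMap children

σ^ : {p : ℕ} → ℕ → Patch p → Patch p
σ^ zero    P = P
σ^ (suc n) P = σ (σ^ n P)

-- The hexagonal patch h_{b,c}: six tiles around the vertex v = (0,0),
-- c at v, b at all other vertices.
m1 : ℤ
m1 = -[1+ 0 ]

hex : {p : ℕ} → 𝔽 p → 𝔽 p → Patch p
hex b c =
    tile up   (+ 0) (+ 0) c b b    -- v is bottom-left
  ∷ tile up   m1    (+ 0) b c b    -- v is bottom-right
  ∷ tile up   (+ 0) m1    b b c    -- v is top
  ∷ tile down m1    m1    c b b    -- v is top-right
  ∷ tile down (+ 0) m1    b c b    -- v is top-left
  ∷ tile down m1    (+ 0) b b c    -- v is bottom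
  ∷ []

Tiling : ℕ → Set₁
Tiling p = Tile p → Set

H : (p : ℕ) → 𝔽 p → 𝔽 p → Tiling p
H p b c t = ∃ λ k → t ∈ σ^ (k * p) (hex b c)

σT : {p : ℕ} → Tiling p → Tiling p
σT T t = ∃ λ s → T s × t ∈ children s

σT^ : {p : ℕ} → ℕ → Tiling p → Tiling p
σT^ zero    T = T
σT^ (suc n) T = σT (σT^ n T)

_≐_ : {p : ℕ} → Tiling p → Tiling p → Set
T ≐ U = ∀ t → (T t → U t) × (U t → T t)

-- Each of the six tiles of h_{b,c} has exactly one child sitting at the
-- central vertex v with the same shape; there the corner at v keeps the value
-- c and the two other corners become b + c.  So σ(h_{b,c}) ⊇ h_{b+c,c}, and
-- iterating, σ^p(h_{b,c}) ⊇ h_{b+pc,c} = h_{b,c}.  Hence σ^p maps the union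
-- of the σ^{kp}(h_{b,c}), k ≥ 0, onto the union over k ≥ 1, which is the
-- same tiling because the k = 0 term is contained in the k = 1 term.
module Submission where

open import Defs
open import Data.Nat using (ℕ; zero; suc; _+_; _*_; _%_; NonZero)
open import Data.Nat.Primality using (Prime)
open import Data.Fin using (toℕ)
open import Relation.Nullary using (¬_)
open import Data.Nat.Properties using (+-comm; +-assoc; *-comm)
open import Data.Nat.DivMod using (_mod_; m%n<n; %-distribˡ-+; m%n%n≡m%n; [m+kn]%n≡m%n; m<n⇒m%n≡m)
open import Data.Nat.GeneralisedArithmetic using (iterate)
open import Data.Fin.Properties using (toℕ-fromℕ<; toℕ-injective; toℕ<n)
open import Data.Integer using (+_)
open import Data.List.Relation.Unary.Any using (here; there)
open import Data.List.Membership.Propositional using (_∈_; find; lose)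
open import Data.List.Membership.Propositional.Properties using (∈-concatMap⁺; ∈-concatMap⁻)
open import Data.List.Relation.Binary.Subset.Propositional.Properties using (concatMap⁺)
open import Data.Product using (_,_)
open import Relation.Binary.PropositionalEquality using (_≡_; refl; cong; cong₂; sym; trans; subst; module ≡-Reasoning)
open import Relation.Unary using (_⊆_; ⋃)

private
  variable
    p : ℕ

⊕-comm : (x y : 𝔽 p) → x ⊕ y ≡ y ⊕ x
⊕-comm {suc n} x y = cong (_mod suc n) (+-comm (toℕ x) (toℕ y))

toℕ-⊕ : (x y : 𝔽 (suc p)) → toℕ (x ⊕ y) ≡ (toℕ x + toℕ y) % suc p
toℕ-⊕ {p} x y = toℕ-fromℕ< (m%n<n (toℕ x + toℕ y) (suc p))

[m%n+k]%n≡[m+k]%n : ∀ m k n .{{_ : NonZero n}} → (m % n + k) % n ≡ (m + k) % n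
[m%n+k]%n≡[m+k]%n m k n = begin
  (m % n + k) % n          ≡⟨ %-distribˡ-+ (m % n) k n ⟩
  (m % n % n + k % n) % n  ≡⟨ cong (λ r → (r + k % n) % n) (m%n%n≡m%n m n) ⟩
  (m % n + k % n) % n      ≡⟨ %-distribˡ-+ m k n ⟨
  (m + k) % n              ∎
  where open ≡-Reasoning

toℕ-iterate-⊕ : (b c : 𝔽 (suc p)) (n : ℕ) →
  toℕ (iterate (_⊕ c) b n) ≡ (toℕ b + n * toℕ c) % suc p
toℕ-iterate-⊕ b c zero = sym (trans (cong (_% _) (+-comm (toℕ b) 0)) (m<n⇒m%n≡m (toℕ<n b)))
toℕ-iterate-⊕ {p} b c (suc n) = begin
  toℕ (iterate (_⊕ c) (b ⊕ c) n)           ≡⟨ toℕ-iterate-⊕ (b ⊕ c) c n ⟩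
  (toℕ (b ⊕ c) + n * toℕ c) % suc p        ≡⟨ cong (λ r → (r + n * toℕ c) % suc p) (toℕ-⊕ b c) ⟩
  ((toℕ b + toℕ c) % suc p + n * toℕ c) % suc p
                                          ≡⟨ [m%n+k]%n≡[m+k]%n (toℕ b + toℕ c) (n * toℕ c) (suc p) ⟩
  (toℕ b + toℕ c + n * toℕ c) % suc p      ≡⟨ cong (_% suc p) (+-assoc (toℕ b) (toℕ c) (n * toℕ c)) ⟩
  (toℕ b + suc n * toℕ c) % suc p          ∎
  where open ≡-Reasoning

iterate-⊕-period : (b c : 𝔽 p) → iterate (_⊕ c) b p ≡ b
iterate-⊕-period {suc p} b c = toℕ-injective (begin
  toℕ (iterate (_⊕ c) b (suc p))   ≡⟨ toℕ-iterate-⊕ b c (suc p) ⟩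
  (toℕ b + suc p * toℕ c) % suc p  ≡⟨ cong (λ r → (toℕ b + r) % suc p) (*-comm (suc p) (toℕ c)) ⟩
  (toℕ b + toℕ c * suc p) % suc p  ≡⟨ [m+kn]%n≡m%n (toℕ b) (toℕ c) (suc p) ⟩
  toℕ b % suc p                    ≡⟨ m<n⇒m%n≡m (toℕ<n b) ⟩
  toℕ b                            ∎)
  where open ≡-Reasoning

⟦_⟧ : Patch p → Tiling p
⟦ P ⟧ t = t ∈ P

∈-σ⁺ : {P : Patch p} {s t : Tile p} → s ∈ P → t ∈ children s → t ∈ σ P
∈-σ⁺ s∈P t∈cs = ∈-concatMap⁺ children (lose s∈P t∈cs)

∈-σ⁻ : {P : Patch p} {t : Tile p} → t ∈ σ P → σT ⟦ P ⟧ t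
∈-σ⁻ {P = P} t∈σP = find (∈-concatMap⁻ children {xs = P} t∈σP)

σ^-+ : (m n : ℕ) (P : Patch p) → σ^ (m + n) P ≡ σ^ m (σ^ n P)
σ^-+ zero    n P = refl
σ^-+ (suc m) n P = cong σ (σ^-+ m n P)

σ^-mono : (n : ℕ) {P Q : Patch p} → ⟦ P ⟧ ⊆ ⟦ Q ⟧ → ⟦ σ^ n P ⟧ ⊆ ⟦ σ^ n Q ⟧
σ^-mono zero    P⊆Q = P⊆Q
σ^-mono (suc n) P⊆Q = concatMap⁺ children (σ^-mono n P⊆Q)

σT^-⟦σ^⟧ : (n : ℕ) {Q : Patch p} {T : Tiling p} → ⟦ Q ⟧ ⊆ T → ⟦ σ^ n Q ⟧ ⊆ σT^ n T
σT^-⟦σ^⟧ zero    Q⊆T t∈Q = Q⊆T t∈Q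
σT^-⟦σ^⟧ (suc n) Q⊆T t∈σⁿ⁺¹Q with ∈-σ⁻ t∈σⁿ⁺¹Q
... | s , s∈σⁿQ , t∈cs = s , σT^-⟦σ^⟧ n Q⊆T s∈σⁿQ , t∈cs

σT^-⋃⟦⟧ : (n : ℕ) (F : ℕ → Patch p) →
  σT^ n (⋃ ℕ (λ k → ⟦ F k ⟧)) ⊆ ⋃ ℕ (λ k → ⟦ σ^ n (F k) ⟧)
σT^-⋃⟦⟧ zero    F t∈T = t∈T
σT^-⋃⟦⟧ (suc n) F (s , s∈σTⁿT , t∈cs) with σT^-⋃⟦⟧ n F s∈σTⁿT
... | k , s∈σⁿF = k , ∈-σ⁺ s∈σⁿF t∈cs

hex-⊆-σ : (b c : 𝔽 p) → ⟦ hex (b ⊕ c) c ⟧ ⊆ ⟦ σ (hex b c) ⟧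
hex-⊆-σ b c = λ where
    (here refl) →
      child (here refl) (here (cong₂ (tile up (+ 0) (+ 0) c) comm comm))
    (there (here refl)) →
      child (there (here refl)) (there (here (cong (tile up m1 (+ 0) (b ⊕ c) c) comm)))
    (there (there (here refl))) →
      child (there (there (here refl))) (there (there (here refl)))
    (there (there (there (here refl)))) →
      child (there (there (there (here refl)))) (here (cong₂ (tile down m1 m1 c) comm comm))
    (there (there (there (there (here refl))))) →
      child (there (there (there (there (here refl)))))
            (there (here (cong (tile down (+ 0) m1 (b ⊕ c) c) comm)))
    (there (there (there (there (there (here refl)))))) →
      child (there (there (there (there (there (here refl))))))
            (there (there (here refl)))
  where
  comm : b ⊕ c ≡ c ⊕ b
  comm = ⊕-comm b c
  child : {s t : Tile _} → s ∈ hex b c → t ∈ children s → t ∈ σ (hex b c)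
  child = ∈-σ⁺

hex-⊆-σ^ : (n : ℕ) (b c : 𝔽 p) → ⟦ hex (iterate (_⊕ c) b n) c ⟧ ⊆ ⟦ σ^ n (hex b c) ⟧
hex-⊆-σ^ zero    b c t∈hex = t∈hex
hex-⊆-σ^ (suc n) b c t∈hex =
  subst (_ ∈_) σⁿ∘σ≡σⁿ⁺¹ (σ^-mono n (hex-⊆-σ b c) (hex-⊆-σ^ n (b ⊕ c) c t∈hex))
  where
  σⁿ∘σ≡σⁿ⁺¹ : σ^ n (σ (hex b c)) ≡ σ^ (suc n) (hex b c)
  σⁿ∘σ≡σⁿ⁺¹ = trans (sym (σ^-+ n 1 (hex b c))) (cong (λ m → σ^ m (hex b c)) (+-comm n 1))

hex-⊆-σ^p : (b c : 𝔽 p) → ⟦ hex b c ⟧ ⊆ ⟦ σ^ p (hex b c) ⟧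
hex-⊆-σ^p {p} b c = subst (λ b′ → ⟦ hex b′ c ⟧ ⊆ ⟦ σ^ p (hex b c) ⟧)
                          (iterate-⊕-period b c) (hex-⊆-σ^ p b c)

σT^p-H-⊆-H : (b c : 𝔽 p) → σT^ p (H p b c) ⊆ H p b c
σT^p-H-⊆-H {p} b c t∈σTᵖH with σT^-⋃⟦⟧ p (λ k → σ^ (k * p) (hex b c)) t∈σTᵖH
... | k , t∈σᵖσᵏᵖ = suc k , subst (_ ∈_) (sym (σ^-+ p (k * p) (hex b c))) t∈σᵖσᵏᵖ

H-⊆-σT^p-H : (b c : 𝔽 p) → H p b c ⊆ σT^ p (H p b c)
H-⊆-σT^p-H {p} b c (zero , t∈hex) =
  σT^-⟦σ^⟧ p (λ s∈hex → zero , s∈hex) (hex-⊆-σ^p b c t∈hex)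
H-⊆-σT^p-H {p} b c (suc k , t∈σ⁽ᵏ⁺¹⁾ᵖ) =
  σT^-⟦σ^⟧ p (λ s∈σᵏᵖ → k , s∈σᵏᵖ) (subst (_ ∈_) (σ^-+ p (k * p) (hex b c)) t∈σ⁽ᵏ⁺¹⁾ᵖ)

mainTheorem5 : (p : ℕ) → Prime p → p % 2 ≡ 1 →
    (b c : 𝔽 p) → ¬ (toℕ c ≡ 0) →
    σT^ p (H p b c) ≐ H p b c
mainTheorem5 p _ _ b c _ t = σT^p-H-⊆-H b c , H-⊆-σT^p-H b c
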